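{- Consider jobs and resources on timeslots $[1,T]$, where the set of all jobs forms a mountain range with mountains $M_1,\dots,M_r$, and every resource is either narrow or wide with respect to these mountains. Let $J$ be a subset of jobs and $R$ a multiset of resources such that $R$ covers $J$. Let $R_1$ and $R_2$ be the sub-multisets of narrow and of wide resources in $R$, respectively, and let $R_2'$ be the multiset obtained from $R_2$ by taking twice the number of copies of each resource. Then $J$ can be partitioned into sets $J_1$ and $J_2$ such that $R_1$ covers $J_1$ and $R_2'$ covers $J_2$.
   Context: Each job $j$ is an interval $[s(j),e(j)]$ of integer timeslots with demand $1$; each resource $i$ is an interval $[s(i),e(i)]$ with integer capacity $w(i)$ (and a cost). A job/resource is active at $t$ if $t$ lies in its interval. For a set $J$ of jobs, $P_J(t)$ is the number of jobs of $J$ active at $t$; for a multiset $R$ of resources, $P_R(t)=\sum_{i\in R\text{ active at }t}w(i)$ (with multiplicity); $R$ covers $J$ if $P_R(t)\ge P_J(t)$ for all $t$. A set $M$ of jobs is a mountain if all its jobs are active at a common timeslot; its span is the set of timeslots at which some job of $M$ is active (an interval). A set of jobs is a mountain range if it is partitioned into mountains $M_1,\dots,M_r$ with pairwise disjoint spans. A resource $i$ intersects a mountain $M$ if its interval meets the span of $M$, and fully spans $M$ if the span of $M$ is contained in its interval. A resource is narrow if its interval is contained in the span of a single mountain, and wide if it fully spans every mountain it intersects. -}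

module Defs where

open import Data.Nat using (ℕ; zero; suc; _+_; _*_; _≤_; _≤?_)
open import Data.Fin using (Fin; zero; suc)
open import Data.Bool using (Bool; true; false; _∧_; if_then_else_)
open import Data.Product using (Σ; _×_; ∃)
open import Relation.Binary.PropositionalEquality using (_≡_)
open import Relation.Nullary.Decidable using (⌊_⌋)

sumFin : (n : ℕ) → (Fin n → ℕ) → ℕ
sumFin zero    f = 0
sumFin (suc n) f = f zero + sumFin n (λ i → f (suc i))

-- an instance: n jobs (each an interval [js j, je j], demand 1) and
-- m resources (each an interval [rs i, re i] with integer capacity w i)
record Instance : Set where
  field
    n  : ℕ
    js : Fin n → ℕ
    je : Fin n → ℕ
    m  : ℕ
    rs : Fin m → ℕ
    re : Fin m → ℕ
    w  : Fin m → ℕ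

activeB : ℕ → ℕ → ℕ → Bool
activeB s e t = ⌊ s ≤? t ⌋ ∧ ⌊ t ≤? e ⌋

Active : ℕ → ℕ → ℕ → Set
Active s e t = s ≤ t × t ≤ e

module _ (I : Instance) where
  open Instance I

  WithinHorizon : ℕ → Set
  WithinHorizon T =
    ((j : Fin n) → 1 ≤ js j × js j ≤ je j × je j ≤ T) ×
    ((i : Fin m) → 1 ≤ rs i × rs i ≤ re i × re i ≤ T)

  PJ : (Fin n → Bool) → ℕ → ℕ
  PJ J t = sumFin n (λ j → if J j ∧ activeB (js j) (je j) t then 1 else 0)

  PR : (Fin m → ℕ) → ℕ → ℕ
  PR R t = sumFin m (λ i → if activeB (rs i) (re i) t then R i * w i else 0)

  Covers : (Fin m → ℕ) → (Fin n → Bool) → Set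
  Covers R J = (t : ℕ) → PJ J t ≤ PR R t

  -- the set of all jobs is a mountain range, partitioned into mountains
  -- M_1..M_r by the assignment mnt : job ↦ its mountain
  module _ {r : ℕ} (mnt : Fin n → Fin r) where

    InSpan : Fin r → ℕ → Set
    InSpan k t = ∃ λ (j : Fin n) → mnt j ≡ k × Active (js j) (je j) t

    IsMountainRange : Set
    IsMountainRange =
      ((k : Fin r) → ∃ λ (t : ℕ) → (j : Fin n) → mnt j ≡ k → Active (js j) (je j) t) ×
      ((k k' : Fin r) (t : ℕ) → InSpan k t → InSpan k' t → k ≡ k')

    Intersects : Fin m → Fin r → Set
    Intersects i k = ∃ λ (t : ℕ) → Active (rs i) (re i) t × InSpan k t

    FullySpans : Fin m → Fin r → Set
    FullySpans i k = (t : ℕ) → InSpan k t → Active (rs i) (re i) t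

    Narrow : Fin m → Set
    Narrow i = ∃ λ (k : Fin r) → (t : ℕ) → Active (rs i) (re i) t → InSpan k t

    Wide : Fin m → Set
    Wide i = (k : Fin r) → Intersects i k → FullySpans i k

module Submission where

-- A multiset R₂ of wide resources has constant load c_k on the span of
-- each mountain M_k: a wide resource active somewhere on the span is active on
-- all of it.  In every mountain we move to J₂ the c_k jobs of J ∩ M_k that start
-- earliest and the c_k jobs that end latest; J₁ is the rest of J.
--   * At a timeslot t of M_k at most 2c_k jobs of J₂ are active, and R₂ doubled
--     provides exactly 2c_k.
--   * If a job j of J₁ is active at t ≤ peak(M_k) then j was not among the c_k
--     earliest starters, so these c_k jobs all start before t and, containing
--     the peak, end after t: they are active at t.  Hence
--     P_{J₁}(t) + c_k ≤ P_J(t) ≤ P_R(t) = P_{R₁}(t) + c_k.  Symmetrically for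
--     t ≥ peak with the latest finishers.

open import Defs
open import Level using (0ℓ)
open import Data.Nat using (ℕ; zero; suc; _+_; _*_; _≤_; _<_; z≤n; s≤s; z<s; _≤?_)
open import Data.Nat.Properties
  using (≤-refl; ≤-reflexive; ≤-trans; ≤-antisym; ≤-total; +-mono-≤; m≤n⇒m≤1+n;
         +-comm; +-identityʳ; +-cancelʳ-≤; *-assoc; *-zeroʳ; *-distribʳ-+; *-distribˡ-+;
         +-commutativeSemigroup; module ≤-Reasoning)
open import Algebra.Properties.CommutativeSemigroup +-commutativeSemigroup using (interchange)
open import Data.Fin using (Fin; zero; suc)
open import Data.Fin.Properties using (any?) renaming (_≟_ to _≟ᶠ_)
open import Data.Bool using (Bool; true; false; _∧_; _∨_; not; if_then_else_)
open import Data.Bool.Properties using (T-≡; ¬-not; if-eta) renaming (_≟_ to _≟ᵇ_)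
open import Data.Product using (Σ; _×_; ∃; _,_; proj₁; proj₂)
open import Data.Sum using (_⊎_; inj₁; inj₂; reduce)
open import Data.Empty using (⊥; ⊥-elim)
open import Function using (_∘_; Equivalence)
open import Relation.Binary.Core using (Rel)
open import Relation.Binary.Definitions using (Total; Transitive)
open import Relation.Binary.PropositionalEquality
  using (_≡_; refl; sym; trans; cong; cong₂; subst)
open import Relation.Nullary using (Dec; yes; no)
open import Relation.Nullary.Decidable using (⌊_⌋; toWitness; dec-true; isYes≗does; ⌊⌋-map′)

conflict : ∀ {a} → a ≡ true → a ≡ false → ⊥
conflict refl ()

∧-elim : ∀ {a b} → a ∧ b ≡ true → a ≡ true × b ≡ true
∧-elim {true} {true} _ = refl , refl

∧-intro : ∀ {a b} → a ≡ true → b ≡ true → a ∧ b ≡ true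
∧-intro refl refl = refl

∨-introˡ : ∀ {a} b → a ≡ true → a ∨ b ≡ true
∨-introˡ b refl = refl

∨-introʳ : ∀ a {b} → b ≡ true → a ∨ b ≡ true
∨-introʳ true  _ = refl
∨-introʳ false h = h

∨-elim : ∀ {a b} → a ∨ b ≡ true → a ≡ true ⊎ b ≡ true
∨-elim {true} _ = inj₁ refl
∨-elim {false} h = inj₂ h

∨-false : ∀ {a b} → a ∨ b ≡ false → a ≡ false × b ≡ false
∨-false {false} {false} _ = refl , refl

not-elim : ∀ {a} → not a ≡ true → a ≡ false
not-elim {false} _ = refl

split-by : ∀ a b → (b ≡ true → a ≡ true) →
  (a ≡ true → (a ∧ not b ≡ true × b ≡ false) ⊎ (a ∧ not b ≡ false × b ≡ true)) ×
  (a ≡ false → a ∧ not b ≡ false × b ≡ false)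
split-by true  true  _   = (λ _ → inj₂ (refl , refl)) , λ ()
split-by true  false _   = (λ _ → inj₁ (refl , refl)) , λ ()
split-by false true  b⊆a with () ← b⊆a refl
split-by false false _   = (λ ()) , λ _ → refl , refl

bool-ext : ∀ {a b} → (a ≡ true → b ≡ true) → (b ≡ true → a ≡ true) → a ≡ b
bool-ext {true} {b} to _ = sym (to refl)
bool-ext {false} {true} _ from = from refl
bool-ext {false} {false} _ _ = refl

dec-sound : ∀ {A : Set} (a? : Dec A) → ⌊ a? ⌋ ≡ true → A
dec-sound a? h = toWitness {a? = a?} (Equivalence.from T-≡ h)

dec-complete : ∀ {A : Set} (a? : Dec A) → A → ⌊ a? ⌋ ≡ true
dec-complete a? a = trans (isYes≗does a?) (dec-true a? a)

sum-cong : ∀ n {f g : Fin n → ℕ} → (∀ i → f i ≡ g i) → sumFin n f ≡ sumFin n g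
sum-cong zero    eq = refl
sum-cong (suc n) eq = cong₂ _+_ (eq zero) (sum-cong n (eq ∘ suc))

sum-mono : ∀ n {f g : Fin n → ℕ} → (∀ i → f i ≤ g i) → sumFin n f ≤ sumFin n g
sum-mono zero    le = z≤n
sum-mono (suc n) le = +-mono-≤ (le zero) (sum-mono n (le ∘ suc))

sum-+ : ∀ n (f g : Fin n → ℕ) → sumFin n (λ i → f i + g i) ≡ sumFin n f + sumFin n g
sum-+ zero    f g = refl
sum-+ (suc n) f g =
  trans (cong (f zero + g zero +_) (sum-+ n (f ∘ suc) (g ∘ suc)))
        (interchange (f zero) (g zero) _ _)

sum-scale : ∀ n c (f : Fin n → ℕ) → sumFin n (λ i → c * f i) ≡ c * sumFin n f
sum-scale zero    c f = sym (*-zeroʳ c)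
sum-scale (suc n) c f =
  trans (cong (c * f zero +_) (sum-scale n c (f ∘ suc))) (sym (*-distribˡ-+ c (f zero) _))

ind : Bool → ℕ
ind b = if b then 1 else 0

-- number of members of P; P_J(t) is literally the count of the jobs of J active at t
count : ∀ {n} → (Fin n → Bool) → ℕ
count {n} P = sumFin n (λ j → ind (P j))

count-none : ∀ {n} (P : Fin n → Bool) → (∀ j → P j ≡ false) → count P ≡ 0
count-none {zero}  P none = refl
count-none {suc n} P none rewrite none zero = count-none (P ∘ suc) (none ∘ suc)

count-mono : ∀ {n} {P Q : Fin n → Bool} → (∀ j → P j ≡ true → Q j ≡ true) → count P ≤ count Q
count-mono {n} {P} {Q} P⊆Q = sum-mono n (λ j → ind-mono (P⊆Q j))
  where
  ind-mono : ∀ {a b} → (a ≡ true → b ≡ true) → ind a ≤ ind b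
  ind-mono {false}         _  = z≤n
  ind-mono {true} {true}   _  = ≤-refl
  ind-mono {true} {false}  ab with () ← ab refl

count-∨ : ∀ {n} (P Q : Fin n → Bool) → count (λ j → P j ∨ Q j) ≤ count P + count Q
count-∨ {n} P Q =
  ≤-trans (sum-mono n (λ j → ind-∨ (P j) (Q j))) (≤-reflexive (sum-+ n _ _))
  where
  ind-∨ : ∀ a b → ind (a ∨ b) ≤ ind a + ind b
  ind-∨ true  b = s≤s z≤n
  ind-∨ false b = ≤-refl

count-disjoint : ∀ {n} (P Q : Fin n → Bool) → (∀ j → P j ≡ true → Q j ≡ true → ⊥) →
                 count P + count Q ≤ count (λ j → P j ∨ Q j)
count-disjoint {n} P Q disj =
  ≤-trans (≤-reflexive (sym (sum-+ n _ _))) (sum-mono n (λ j → ind-∨ (disj j)))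
  where
  ind-∨ : ∀ {a b} → (a ≡ true → b ≡ true → ⊥) → ind a + ind b ≤ ind (a ∨ b)
  ind-∨ {true} {true} d with () ← d refl refl
  ind-∨ {true} {false} _ = ≤-refl
  ind-∨ {false}        _ = ≤-refl

count-singleton : ∀ {n} (y : Fin n) → count (λ j → ⌊ j ≟ᶠ y ⌋) ≡ 1
count-singleton {suc n} zero    = cong suc (count-none (λ (i : Fin n) → ⌊ suc i ≟ᶠ zero ⌋) (λ _ → refl))
count-singleton {suc n} (suc y) =
  trans (sum-cong n (λ j → cong ind (⌊⌋-map′ _ _ (j ≟ᶠ y)))) (count-singleton y)

count-insert : ∀ {n} (P : Fin n → Bool) {y} → P y ≡ false →
               count (λ j → P j ∨ ⌊ j ≟ᶠ y ⌋) ≡ count P + 1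
count-insert P {y} Py = ≤-antisym
  (≤-trans (count-∨ P _) (≤-reflexive (cong (count P +_) (count-singleton y))))
  (≤-trans (≤-reflexive (cong (count P +_) (sym (count-singleton y)))) (count-disjoint P _ fresh))
  where
  fresh : ∀ j → P j ≡ true → ⌊ j ≟ᶠ y ⌋ ≡ true → ⊥
  fresh j Pj j≡y = conflict (subst (λ x → P x ≡ true) (dec-sound (j ≟ᶠ y) j≡y) Pj) Py

count-witness : ∀ {n} {P : Fin n → Bool} {b} → (∀ j → P j ≡ true → count P ≤ b) → count P ≤ b
count-witness {P = P} bound with any? (λ j → P j ≟ᵇ true)
... | yes (j , Pj) = bound j Pj
... | no  empty    = ≤-trans (≤-reflexive (count-none P (λ j → ¬-not (λ Pj → empty (j , Pj))))) z≤n

-- Least elements and prefixes under a total preorder on Fin n.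

total-refl : ∀ {A : Set} {_≼_ : Rel A 0ℓ} → Total _≼_ → ∀ x → x ≼ x
total-refl total x = reduce (total x x)

least : ∀ {n} (_≼_ : Rel (Fin n) 0ℓ) → Total _≼_ → Transitive _≼_ → (P : Fin n → Bool) →
        (∀ j → P j ≡ false) ⊎ ∃ λ y → P y ≡ true × (∀ j → P j ≡ true → y ≼ j)
least {zero} _ _ _ P = inj₁ λ ()
least {suc n} _≼_ total ≼-trans P
  with least (λ i j → suc i ≼ suc j) (λ i j → total (suc i) (suc j)) ≼-trans (P ∘ suc)
     | P zero in P₀
... | inj₁ none            | false = inj₁ λ { zero → P₀ ; (suc j) → none j }
... | inj₁ none            | true  = inj₂ (zero , P₀ , λ
        { zero _ → total-refl total zero ; (suc j) Pj → ⊥-elim (conflict Pj (none j)) })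
... | inj₂ (y , Py , min)  | false = inj₂ (suc y , Py , λ
        { zero P0 → ⊥-elim (conflict P0 P₀) ; (suc j) Pj → min j Pj })
... | inj₂ (y , Py , min)  | true with total zero (suc y)
...   | inj₁ 0≼y = inj₂ (zero , P₀ , λ
          { zero _ → total-refl total zero
          ; (suc j) Pj → ≼-trans 0≼y (min j Pj) })
...   | inj₂ y≼0 = inj₂ (suc y , Py , λ { zero _ → y≼0 ; (suc j) Pj → min j Pj })

record Prefix {n} (_≼_ : Rel (Fin n) 0ℓ) (S : Fin n → Bool) (c : ℕ) : Set where
  field
    L        : Fin n → Bool
    L⊆S      : ∀ j → L j ≡ true → S j ≡ true
    small    : count L ≤ c
    blocking : ∀ y → S y ≡ true → L y ≡ false → count L ≡ c × (∀ x → L x ≡ true → x ≼ y)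

module _ {n} {_≼_ : Rel (Fin n) 0ℓ} (total : Total _≼_) (≼-trans : Transitive _≼_)
         (S : Fin n → Bool) where

  extend : ∀ {c} → Prefix _≼_ S c → Prefix _≼_ S (suc c)
  extend {c} p with least _≼_ total ≼-trans (λ j → S j ∧ not (Prefix.L p j))
  ... | inj₁ none = record
    { L = L ; L⊆S = L⊆S ; small = m≤n⇒m≤1+n small
    ; blocking = λ y Sy Ly → ⊥-elim (conflict (∧-intro Sy (cong not Ly)) (none y)) }
    where open Prefix p
  ... | inj₂ (y₀ , fresh , min) = record
    { L = L′ ; L⊆S = L′⊆S ; small = ≤-reflexive size
    ; blocking = λ y Sy L′y → size , below y Sy (∨-false L′y) }
    where
    open Prefix p
    Ly₀ : L y₀ ≡ false
    Ly₀ = ¬-not (λ Ly₀ → conflict (proj₂ (∧-elim fresh)) (cong not Ly₀))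
    L′ : Fin n → Bool
    L′ j = L j ∨ ⌊ j ≟ᶠ y₀ ⌋
    size : count L′ ≡ suc c
    size = trans (count-insert L Ly₀)
                 (trans (cong (_+ 1) (proj₁ (blocking y₀ (proj₁ (∧-elim fresh)) Ly₀))) (+-comm c 1))
    L′⊆S : ∀ j → L′ j ≡ true → S j ≡ true
    L′⊆S j h with ∨-elim h
    ... | inj₁ Lj   = L⊆S j Lj
    ... | inj₂ j≡y₀ = subst (λ x → S x ≡ true) (sym (dec-sound (j ≟ᶠ y₀) j≡y₀)) (proj₁ (∧-elim fresh))
    below : ∀ y → S y ≡ true → L y ≡ false × ⌊ y ≟ᶠ y₀ ⌋ ≡ false → ∀ x → L′ x ≡ true → x ≼ y
    below y Sy (Ly , _) x h with ∨-elim h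
    ... | inj₁ Lx   = proj₂ (blocking y Sy Ly) x Lx
    ... | inj₂ x≡y₀ = subst (_≼ y) (sym (dec-sound (x ≟ᶠ y₀) x≡y₀)) (min y (∧-intro Sy (cong not Ly)))

  prefix : ∀ c → Prefix _≼_ S c
  prefix zero = record
    { L = λ _ → false ; L⊆S = λ _ () ; small = ≤-reflexive (count-none (λ (_ : Fin n) → false) (λ _ → refl))
    ; blocking = λ _ _ _ → count-none (λ (_ : Fin n) → false) (λ _ → refl) , λ _ () }
  prefix (suc c) = extend (prefix c)

module _ (I : Instance) where
  open Instance I

  PR-additive : (R R₁ R₂ : Fin m → ℕ) → (∀ i → R₁ i + R₂ i ≡ R i) →
                ∀ t → PR I R t ≡ PR I R₁ t + PR I R₂ t
  PR-additive R R₁ R₂ split t = trans (sum-cong m term) (sum-+ m _ _)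
    where
    term : ∀ i → (if activeB (rs i) (re i) t then R i * w i else 0)
               ≡ (if activeB (rs i) (re i) t then R₁ i * w i else 0)
               + (if activeB (rs i) (re i) t then R₂ i * w i else 0)
    term i with activeB (rs i) (re i) t
    ... | true  = trans (cong (_* w i) (sym (split i))) (*-distribʳ-+ (w i) (R₁ i) (R₂ i))
    ... | false = refl

  PR-scale : ∀ c (R : Fin m → ℕ) t → PR I (λ i → c * R i) t ≡ c * PR I R t
  PR-scale c R t = trans (sum-cong m term) (sum-scale m c _)
    where
    term : ∀ i → (if activeB (rs i) (re i) t then c * R i * w i else 0)
               ≡ c * (if activeB (rs i) (re i) t then R i * w i else 0)
    term i with activeB (rs i) (re i) t
    ... | true  = *-assoc c (R i) (w i)
    ... | false = sym (*-zeroʳ c)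

-- Activity, mountains and wide resources.

active-sound : ∀ {s e t} → activeB s e t ≡ true → Active s e t
active-sound {s} {e} {t} h = dec-sound (s ≤? t) (proj₁ (∧-elim h)) , dec-sound (t ≤? e) (proj₂ (∧-elim h))

active-complete : ∀ {s e t} → Active s e t → activeB s e t ≡ true
active-complete {s} {e} {t} (s≤t , t≤e) = ∧-intro (dec-complete (s ≤? t) s≤t) (dec-complete (t ≤? e) t≤e)

module Mountains (I : Instance) {r} (mnt : Fin (Instance.n I) → Fin r)
                 (MR : IsMountainRange I mnt) where
  open Instance I

  act : Fin n → ℕ → Bool
  act j t = activeB (js j) (je j) t

  peak : Fin r → ℕ
  peak k = proj₁ (proj₁ MR k)

  peak-active : ∀ j → Active (js j) (je j) (peak (mnt j))
  peak-active j = proj₂ (proj₁ MR (mnt j)) j refl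

  -- spans are disjoint, so jobs active at a common timeslot share their mountain
  same-mountain : ∀ {j j′ t} → act j t ≡ true → act j′ t ≡ true → mnt j ≡ mnt j′
  same-mountain {j} {j′} {t} h h′ =
    proj₂ MR (mnt j) (mnt j′) t (j , refl , active-sound h) (j′ , refl , active-sound h′)

  wide-active : ∀ {i k t t′} → Wide I mnt i → InSpan I mnt k t → InSpan I mnt k t′ →
                activeB (rs i) (re i) t ≡ true → activeB (rs i) (re i) t′ ≡ true
  wide-active {k = k} {t} {t′} wi sp sp′ h = active-complete (wi k (t , active-sound h , sp) t′ sp′)

  wide-load-constant : (R₂ : Fin m → ℕ) → (∀ i → 0 < R₂ i → Wide I mnt i) →
                       ∀ {k t t′} → InSpan I mnt k t → InSpan I mnt k t′ → PR I R₂ t ≡ PR I R₂ t′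
  wide-load-constant R₂ wide {k} {t} {t′} sp sp′ = sum-cong m term
    where
    term : ∀ i → (if activeB (rs i) (re i) t then R₂ i * w i else 0)
               ≡ (if activeB (rs i) (re i) t′ then R₂ i * w i else 0)
    term i with R₂ i in eq
    ... | zero  = trans (if-eta (activeB (rs i) (re i) t)) (sym (if-eta (activeB (rs i) (re i) t′)))
    ... | suc x = cong (λ b → if b then suc x * w i else 0)
                       (bool-ext (wide-active wi sp sp′) (wide-active wi sp′ sp))
      where
      wi : Wide I mnt i
      wi = wide i (subst (0 <_) (sym eq) z<s)

-- The split of J and its covering properties.

module Split (I : Instance) {r} (mnt : Fin (Instance.n I) → Fin r) (MR : IsMountainRange I mnt)
             (J : Fin (Instance.n I) → Bool) (R₂ : Fin (Instance.m I) → ℕ)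
             (wide : ∀ i → 0 < R₂ i → Wide I mnt i) where
  open Instance I
  open Mountains I mnt MR

  c : Fin r → ℕ
  c k = PR I R₂ (peak k)

  load-active : ∀ {j t} → act j t ≡ true → PR I R₂ t ≡ c (mnt j)
  load-active {j} h = wide-load-constant R₂ wide (j , refl , active-sound h) (j , refl , peak-active j)

  S : Fin r → Fin n → Bool
  S k j = J j ∧ ⌊ mnt j ≟ᶠ k ⌋

  S-elim : ∀ {k j} → S k j ≡ true → J j ≡ true × mnt j ≡ k
  S-elim {k} {j} h = proj₁ (∧-elim h) , dec-sound (mnt j ≟ᶠ k) (proj₂ (∧-elim h))

  _≼ˢ_ _≼ᵉ_ : Rel (Fin n) 0ℓ
  i ≼ˢ j = js i ≤ js j
  i ≼ᵉ j = je j ≤ je i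

  early : (k : Fin r) → Prefix _≼ˢ_ (S k) (c k)
  early k = prefix (λ i j → ≤-total (js i) (js j)) ≤-trans (S k) (c k)

  late : (k : Fin r) → Prefix _≼ᵉ_ (S k) (c k)
  late k = prefix (λ i j → ≤-total (je j) (je i)) (λ p q → ≤-trans q p) (S k) (c k)

  Early Late : Fin r → Fin n → Bool
  Early k = Prefix.L (early k)
  Late  k = Prefix.L (late k)

  J₂ J₁ : Fin n → Bool
  J₂ j = Early (mnt j) j ∨ Late (mnt j) j
  J₁ j = J j ∧ not (J₂ j)

  S-intro : ∀ {j} → J j ≡ true → S (mnt j) j ≡ true
  S-intro {j} Jj = ∧-intro Jj (dec-complete (mnt j ≟ᶠ mnt j) refl)

  peak-active-S : ∀ {k x} → S k x ≡ true → Active (js x) (je x) (peak k)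
  peak-active-S {x = x} Sx with S-elim Sx
  ... | _ , refl = peak-active x

  Early⊆J₂ : ∀ k x → Early k x ≡ true → J₂ x ≡ true
  Early⊆J₂ k x h with S-elim (Prefix.L⊆S (early k) x h)
  ... | _ , refl = ∨-introˡ _ h

  Late⊆J₂ : ∀ k x → Late k x ≡ true → J₂ x ≡ true
  Late⊆J₂ k x h with S-elim (Prefix.L⊆S (late k) x h)
  ... | _ , refl = ∨-introʳ _ h

  J₁-elim : ∀ {j} → J₁ j ≡ true → J j ≡ true × J₂ j ≡ false
  J₁-elim {j} h = proj₁ (∧-elim {J j} h) , not-elim (proj₂ (∧-elim {J j} h))

  J₂⊆J : ∀ j → J₂ j ≡ true → J j ≡ true
  J₂⊆J j h with ∨-elim h
  ... | inj₁ e = proj₁ (S-elim (Prefix.L⊆S (early (mnt j)) j e))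
  ... | inj₂ l = proj₁ (S-elim (Prefix.L⊆S (late (mnt j)) j l))

  -- at a timeslot of mountain k only early and late jobs of k belong to J₂, and
  -- there are at most 2c_k of them, which R₂ doubled provides
  cover₂ : Covers I (λ i → 2 * R₂ i) J₂
  cover₂ t = count-witness bound
    where
    bound : ∀ j* → (J₂ j* ∧ act j* t) ≡ true → PJ I J₂ t ≤ PR I (λ i → 2 * R₂ i) t
    bound j* h = begin
      PJ I J₂ t                           ≤⟨ count-mono in-mountain ⟩
      count (λ j → Early k j ∨ Late k j)  ≤⟨ count-∨ (Early k) (Late k) ⟩
      count (Early k) + count (Late k)    ≤⟨ +-mono-≤ (Prefix.small (early k)) (Prefix.small (late k)) ⟩
      c k + c k                           ≡⟨ cong (c k +_) (sym (+-identityʳ (c k))) ⟩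
      2 * c k                             ≡⟨ cong (2 *_) (sym (load-active (proj₂ (∧-elim {J₂ j*} h)))) ⟩
      2 * PR I R₂ t                       ≡⟨ sym (PR-scale I 2 R₂ t) ⟩
      PR I (λ i → 2 * R₂ i) t             ∎
      where
      open ≤-Reasoning
      k : Fin r
      k = mnt j*
      in-mountain : ∀ j → (J₂ j ∧ act j t) ≡ true → (Early k j ∨ Late k j) ≡ true
      in-mountain j h′ = subst (λ k′ → (Early k′ j ∨ Late k′ j) ≡ true)
        (same-mountain (proj₂ (∧-elim {J₂ j} h′)) (proj₂ (∧-elim {J₂ j*} h))) (proj₁ (∧-elim {J₂ j} h′))

  module _ (R R₁ : Fin m → ℕ) (split : ∀ i → R₁ i + R₂ i ≡ R i) (cover : Covers I R J) where

    -- If the jobs of S k preceding j* are active at t, then all c_k jobs of p are,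
    -- and they are disjoint from J₁; so P_{J₁}(t) + c_k ≤ P_J(t) ≤ P_{R₁}(t) + c_k.
    cover₁-at : ∀ {_≼_ : Rel (Fin n) 0ℓ} k (p : Prefix _≼_ (S k) (c k)) →
                (∀ x → Prefix.L p x ≡ true → J₂ x ≡ true) →
                ∀ t j* → S k j* ≡ true → Prefix.L p j* ≡ false → act j* t ≡ true →
                (∀ x → S k x ≡ true → x ≼ j* → act x t ≡ true) →
                PJ I J₁ t ≤ PR I R₁ t
    cover₁-at {_≼_} k p L⊆J₂ t j* Sj Lj aj reach = +-cancelʳ-≤ (c k) _ _ (begin
      PJ I J₁ t + c k                                   ≡⟨ cong (PJ I J₁ t +_) (sym (proj₁ blocked)) ⟩
      PJ I J₁ t + count L                               ≤⟨ +-mono-≤ ≤-refl (count-mono L-active) ⟩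
      PJ I J₁ t + count (λ x → L x ∧ act x t)           ≤⟨ count-disjoint _ _ disjoint ⟩
      count (λ x → (J₁ x ∧ act x t) ∨ (L x ∧ act x t))  ≤⟨ count-mono within-J ⟩
      PJ I J t                                          ≤⟨ cover t ⟩
      PR I R t                                          ≡⟨ PR-additive I R R₁ R₂ split t ⟩
      PR I R₁ t + PR I R₂ t                             ≡⟨ cong (PR I R₁ t +_) load ⟩
      PR I R₁ t + c k                                   ∎)
      where
      open ≤-Reasoning
      open Prefix p using (L; L⊆S; blocking)
      blocked : count L ≡ c k × (∀ x → L x ≡ true → x ≼ j*)
      blocked = blocking j* Sj Lj
      load : PR I R₂ t ≡ c k
      load = trans (load-active aj) (cong c (proj₂ (S-elim Sj)))
      L-active : ∀ x → L x ≡ true → (L x ∧ act x t) ≡ true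
      L-active x Lx = ∧-intro Lx (reach x (L⊆S x Lx) (proj₂ blocked x Lx))
      disjoint : ∀ x → (J₁ x ∧ act x t) ≡ true → (L x ∧ act x t) ≡ true → ⊥
      disjoint x h₁ hL =
        conflict (L⊆J₂ x (proj₁ (∧-elim {L x} hL))) (proj₂ (J₁-elim (proj₁ (∧-elim {J₁ x} h₁))))
      within-J : ∀ x → ((J₁ x ∧ act x t) ∨ (L x ∧ act x t)) ≡ true → (J x ∧ act x t) ≡ true
      within-J x h with ∨-elim h
      ... | inj₁ h₁ = ∧-intro (proj₁ (J₁-elim (proj₁ (∧-elim {J₁ x} h₁)))) (proj₂ (∧-elim {J₁ x} h₁))
      ... | inj₂ hL = ∧-intro (proj₁ (S-elim (L⊆S x (proj₁ (∧-elim {L x} hL))))) (proj₂ (∧-elim {L x} hL))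

    -- before the peak use the early jobs, after it the late ones
    cover₁ : Covers I R₁ J₁
    cover₁ t = count-witness bound
      where
      bound : ∀ j* → (J₁ j* ∧ act j* t) ≡ true → PJ I J₁ t ≤ PR I R₁ t
      bound j* h with ∧-elim {J₁ j*} h
      ... | J₁j , aj with J₁-elim J₁j | ≤-total t (peak (mnt j*))
      ... | Jj , not-J₂ | inj₁ t≤peak =
        cover₁-at (mnt j*) (early (mnt j*)) (Early⊆J₂ _) t j* (S-intro Jj) (proj₁ (∨-false not-J₂)) aj
          λ x Sx x≼j* → active-complete
            (≤-trans x≼j* (proj₁ (active-sound aj)) , ≤-trans t≤peak (proj₂ (peak-active-S Sx)))
      ... | Jj , not-J₂ | inj₂ peak≤t =
        cover₁-at (mnt j*) (late (mnt j*)) (Late⊆J₂ _) t j* (S-intro Jj) (proj₂ (∨-false not-J₂)) aj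
          λ x Sx j*≼x → active-complete
            (≤-trans (proj₁ (peak-active-S Sx)) peak≤t , ≤-trans (proj₂ (active-sound aj)) j*≼x)

lemma5 : (I : Instance) (T : ℕ) → WithinHorizon I T →
    (r : ℕ) (mnt : Fin (Instance.n I) → Fin r) → IsMountainRange I mnt →
    ((i : Fin (Instance.m I)) → Narrow I mnt i ⊎ Wide I mnt i) →
    (J : Fin (Instance.n I) → Bool) (R : Fin (Instance.m I) → ℕ) →
    Covers I R J →
    (R₁ R₂ : Fin (Instance.m I) → ℕ) →
    ((i : Fin (Instance.m I)) → R₁ i + R₂ i ≡ R i) →
    ((i : Fin (Instance.m I)) → 0 < R₁ i → Narrow I mnt i) →
    ((i : Fin (Instance.m I)) → 0 < R₂ i → Wide I mnt i) →
    Σ (Fin (Instance.n I) → Bool) λ J₁ → Σ (Fin (Instance.n I) → Bool) λ J₂ →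
      ((j : Fin (Instance.n I)) →
        (J j ≡ true → (J₁ j ≡ true × J₂ j ≡ false) ⊎ (J₁ j ≡ false × J₂ j ≡ true)) ×
        (J j ≡ false → J₁ j ≡ false × J₂ j ≡ false)) ×
      Covers I R₁ J₁ × Covers I (λ i → 2 * R₂ i) J₂
lemma5 I T _ r mnt MR _ J R cover R₁ R₂ split _ wide =
  J₁ , J₂ , (λ j → split-by (J j) (J₂ j) (J₂⊆J j)) , cover₁ R R₁ split cover , cover₂
  where open Split I mnt MR J R₂ wide
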